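{- Let $R$ be a commutative ring with identity, let $G$ be an abelian group (written additively) with identity $0_G$, and let $T:\tau R[[\tau]]\to G$ be an injective map with $T(0)=0_G$. Suppose $F\in R[[X,Y]]$ has zero constant term and satisfies $T(g)+T(h)=T(F(g,h))$ for all $g,h\in\tau R[[\tau]]$. Then $F$ is a formal group law over $R$.
   Context: A formal group law over $R$ is a power series $F\in R[[X,Y]]$ such that $F(X,0)=X$, $F(X,Y)=F(Y,X)$ and $F(F(X,Y),Z)=F(X,F(Y,Z))$. Here $\tau R[[\tau]]$ is the set of power series in $\tau$ over $R$ with zero constant term. -}

module Defs where

open import Level using (_⊔_)
open import Data.Nat using (ℕ; zero; suc; _∸_)
open import Data.Fin using (Fin)
import Data.Fin as F
open import Data.Vec using (Vec; []; _∷_; replicate)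
import Data.Vec as V
open import Data.Product using (Σ; proj₁)
open import Algebra.Bundles using (CommutativeRing; AbelianGroup)

-- PS 0 = R,  PS (suc k) = ℕ → PS k, i.e. R[[X₀,…,X_{k-1}]] as
-- nested one-variable series (f n = coefficient of X₀ⁿ, a series in the
-- remaining variables).
module PowerSeries {c ℓ} (R : CommutativeRing c ℓ) where
  open CommutativeRing R

  PS : ℕ → Set c
  PS zero    = Carrier
  PS (suc k) = ℕ → PS k

  infix 4 _≈ₚ_
  _≈ₚ_ : ∀ {k} → PS k → PS k → Set ℓ
  _≈ₚ_ {zero}  a b = a ≈ b
  _≈ₚ_ {suc k} f g = ∀ n → _≈ₚ_ {k} (f n) (g n)

  0ₚ : ∀ {k} → PS k
  0ₚ {zero}  = 0#
  0ₚ {suc k} = λ _ → 0ₚ {k}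

  1ₚ : ∀ {k} → PS k
  1ₚ {zero}  = 1#
  1ₚ {suc k} zero    = 1ₚ {k}
  1ₚ {suc k} (suc _) = 0ₚ {k}

  infixl 6 _+ₚ_
  _+ₚ_ : ∀ {k} → PS k → PS k → PS k
  _+ₚ_ {zero}  a b = a + b
  _+ₚ_ {suc k} f g = λ n → _+ₚ_ {k} (f n) (g n)

  sumₚ : ∀ {k} → ℕ → (ℕ → PS k) → PS k
  sumₚ {k} zero    f = 0ₚ {k}
  sumₚ {k} (suc n) f = _+ₚ_ {k} (sumₚ {k} n f) (f n)

  infixl 7 _*ₚ_
  _*ₚ_ : ∀ {k} → PS k → PS k → PS k
  _*ₚ_ {zero}  a b = a * b
  _*ₚ_ {suc k} f g = λ n → sumₚ {k} (suc n) (λ i → _*ₚ_ {k} (f i) (g (n ∸ i)))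

  infixr 8 _^ₚ_
  _^ₚ_ : ∀ {k} → PS k → ℕ → PS k
  _^ₚ_ {k} f zero    = 1ₚ {k}
  _^ₚ_ {k} f (suc n) = _*ₚ_ {k} f (_^ₚ_ {k} f n)

  coeff : ∀ {k} → Vec ℕ k → PS k → Carrier
  coeff {zero}  []      a = a
  coeff {suc k} (n ∷ m) f = coeff {k} m (f n)

  build : ∀ {k} → (Vec ℕ k → Carrier) → PS k
  build {zero}  c = c []
  build {suc k} c = λ n → build {k} (λ m → c (n ∷ m))

  var : ∀ {k} → Fin k → PS k
  var {suc k} F.zero    (suc zero) = 1ₚ {k}
  var {suc k} F.zero    _          = 0ₚ {k}
  var {suc k} (F.suc i) zero       = var {k} i
  var {suc k} (F.suc i) (suc _)    = 0ₚ {k}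

  constTerm : ∀ {k} → PS k → Carrier
  constTerm {k} f = coeff {k} (replicate k 0) f

  totalDegree : ∀ {k} → Vec ℕ k → ℕ
  totalDegree = V.sum

  -- The coefficient of a monomial of total degree d
  -- in F(A,B) = Σ_{i,j} F_{ij} AⁱBʲ only receives contributions from
  -- i + j ≤ d (since A, B have zero constant term), so it is the finite sum
  --   Σ_{i ≤ d} Σ_{j ≤ d - i} F_{ij} · coeff_m (Aⁱ Bʲ).
  compose : ∀ {k} → PS 2 → PS k → PS k → PS k
  compose {k} F A B = build {k} λ m →
    let d = totalDegree m in
    sumₚ {0} (suc d) λ i → sumₚ {0} (suc (d ∸ i)) λ j →
      F i j * coeff {k} m (_*ₚ_ {k} (_^ₚ_ {k} A i) (_^ₚ_ {k} B j))

  τPS : Set (c ⊔ ℓ)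
  τPS = Σ (PS 1) (λ g → g 0 ≈ 0#)

  X₁ : PS 1
  X₁ = var {1} F.zero

  X₂ Y₂ : PS 2
  X₂ = var {2} F.zero
  Y₂ = var {2} (F.suc F.zero)

  X₃ Y₃ Z₃ : PS 3
  X₃ = var {3} F.zero
  Y₃ = var {3} (F.suc F.zero)
  Z₃ = var {3} (F.suc (F.suc F.zero))

  record IsFormalGroupLaw (F : PS 2) : Set ℓ where
    field
      identity    : _≈ₚ_ {1} (compose {1} F X₁ (0ₚ {1})) X₁
      commutative : _≈ₚ_ {2} (compose {2} F X₂ Y₂) (compose {2} F Y₂ X₂)
      associative : _≈ₚ_ {3} (compose {3} F (compose {3} F X₃ Y₃) Z₃)
                             (compose {3} F X₃ (compose {3} F Y₃ Z₃))

-- Injectivity of T, with associativity and commutativity in G, gives F(g,h) = F(h,g),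
-- F(F(g,h),e) = F(g,F(h,e)) and F(X,0) = X for one-variable series of order ≥ 1. To pass to
-- two and three variables use Kronecker substitution κ_N, X_i ↦ τ^(N^(k-1-i)): it is a ring
-- homomorphism preserving order, hence commutes with substitution into F, and a series is
-- determined by its images under κ_N for all large N, because once N exceeds the exponents
-- involved the exponent of τ is the base-N expansion of the monomial.
module Submission where

open import Defs
open import Level using (_⊔_)
open import Data.Nat as ℕ using (ℕ; zero; suc; _∸_; _≤_; _<_; z≤n; s≤s; _≤?_)
import Data.Nat.Properties as ℕₚ
open import Data.Nat.Induction using (<-rec)
open import Data.Fin as Fin using (Fin)
open import Data.Vec using (Vec; []; _∷_)
open import Data.Product using (_,_; proj₁)
open import Algebra.Bundles using (CommutativeRing; AbelianGroup)
open import Algebra.Structures using (IsCommutativeRing)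
open import Relation.Binary.PropositionalEquality as ≡ using (_≡_)
open import Relation.Nullary using (yes; no)
open import Function using (_∘_)

module SeriesRing {c ℓ} (R : CommutativeRing c ℓ) where
  open PowerSeries R
  private module R = CommutativeRing R

  -ₚ_ : ∀ {k} → PS k → PS k
  -ₚ_ {zero}  a = R.- a
  -ₚ_ {suc k} f = λ n → -ₚ_ {k} (f n)

  IsSeriesRing : ℕ → Set (c ⊔ ℓ)
  IsSeriesRing k = IsCommutativeRing (_≈ₚ_ {k}) (_+ₚ_ {k}) (_*ₚ_ {k}) (-ₚ_ {k}) (0ₚ {k}) (1ₚ {k})

  module Layer (k : ℕ) (isSeriesRingₖ : IsSeriesRing k) where
    PS-commutativeRing : CommutativeRing c ℓ
    PS-commutativeRing = record { isCommutativeRing = isSeriesRingₖ }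

    open CommutativeRing PS-commutativeRing public
    open import Relation.Binary.Reasoning.Setoid setoid
    open import Algebra.Properties.CommutativeSemigroup *-commutativeSemigroup public
      using () renaming (interchange to *-interchange)

    ∑ : ℕ → (ℕ → PS k) → PS k
    ∑ = sumₚ {k}

    ∑-cong< : ∀ n {f g : ℕ → PS k} → (∀ i → i < n → f i ≈ g i) → ∑ n f ≈ ∑ n g
    ∑-cong< zero    f≈g = refl
    ∑-cong< (suc n) f≈g = +-cong (∑-cong< n (λ i i<n → f≈g i (ℕₚ.m<n⇒m<1+n i<n))) (f≈g n ℕₚ.≤-refl)

    ∑-cong : ∀ n {f g : ℕ → PS k} → (∀ i → f i ≈ g i) → ∑ n f ≈ ∑ n g
    ∑-cong n f≈g = ∑-cong< n (λ i _ → f≈g i)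

    ∑-zero : ∀ n {f : ℕ → PS k} → (∀ i → i < n → f i ≈ 0#) → ∑ n f ≈ 0#
    ∑-zero zero    f≈0 = refl
    ∑-zero (suc n) f≈0 =
      trans (+-cong (∑-zero n (λ i i<n → f≈0 i (ℕₚ.m<n⇒m<1+n i<n))) (f≈0 n ℕₚ.≤-refl)) (+-identityˡ 0#)

    ∑-+ : ∀ n (f g : ℕ → PS k) → ∑ n (λ i → f i + g i) ≈ ∑ n f + ∑ n g
    ∑-+ zero    f g = sym (+-identityˡ 0#)
    ∑-+ (suc n) f g = trans (+-congʳ (∑-+ n f g)) (+-interchange (∑ n f) (∑ n g) (f n) (g n))
      where open import Algebra.Properties.CommutativeSemigroup +-commutativeSemigroup
              using () renaming (interchange to +-interchange)

    ∑-*ˡ : ∀ n x (f : ℕ → PS k) → x * ∑ n f ≈ ∑ n (λ i → x * f i)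
    ∑-*ˡ zero    x f = zeroʳ x
    ∑-*ˡ (suc n) x f = trans (distribˡ x _ _) (+-congʳ (∑-*ˡ n x f))

    ∑-*ʳ : ∀ n x (f : ℕ → PS k) → ∑ n f * x ≈ ∑ n (λ i → f i * x)
    ∑-*ʳ zero    x f = zeroˡ x
    ∑-*ʳ (suc n) x f = trans (distribʳ x _ _) (+-congʳ (∑-*ʳ n x f))

    ∑-head : ∀ n (f : ℕ → PS k) → ∑ (suc n) f ≈ f 0 + ∑ n (f ∘ suc)
    ∑-head zero    f = trans (+-identityˡ _) (sym (+-identityʳ _))
    ∑-head (suc n) f = trans (+-congʳ (∑-head n f)) (+-assoc _ _ _)

    ∑-split : ∀ a b (f : ℕ → PS k) → ∑ (a ℕ.+ b) f ≈ ∑ a f + ∑ b (λ i → f (a ℕ.+ i))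
    ∑-split a zero f = trans (reflexive (≡.cong (λ n → ∑ n f) (ℕₚ.+-identityʳ a))) (sym (+-identityʳ _))
    ∑-split a (suc b) f = begin
      ∑ (a ℕ.+ suc b) f                              ≡⟨ ≡.cong (λ n → ∑ n f) (ℕₚ.+-suc a b) ⟩
      ∑ (a ℕ.+ b) f + f (a ℕ.+ b)                    ≈⟨ +-congʳ (∑-split a b f) ⟩
      (∑ a f + ∑ b (λ i → f (a ℕ.+ i))) + f (a ℕ.+ b) ≈⟨ +-assoc _ _ _ ⟩
      ∑ a f + ∑ (suc b) (λ i → f (a ℕ.+ i))          ∎

    ∑-splitAt : ∀ a n (f : ℕ → PS k) → a ≤ n → ∑ n f ≈ ∑ a f + ∑ (n ∸ a) (λ i → f (a ℕ.+ i))
    ∑-splitAt a n f a≤n =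
      trans (reflexive (≡.cong (λ m → ∑ m f) (≡.sym (ℕₚ.m+[n∸m]≡n a≤n)))) (∑-split a (n ∸ a) f)

    ∑-reverse : ∀ n (f : ℕ → PS k) → ∑ n f ≈ ∑ n (λ i → f (n ∸ suc i))
    ∑-reverse zero    f = refl
    ∑-reverse (suc n) f = begin
      ∑ n f + f n                         ≈⟨ +-congʳ (∑-reverse n f) ⟩
      ∑ n (λ i → f (n ∸ suc i)) + f n     ≈⟨ +-comm _ _ ⟩
      f n + ∑ n (λ i → f (n ∸ suc i))     ≈⟨ ∑-head n (λ i → f (n ∸ i)) ⟨
      ∑ (suc n) (λ i → f (suc n ∸ suc i)) ∎

    ∑-antidiagonals : ∀ n (φ : ℕ → ℕ → PS k) →
      ∑ n (λ s → ∑ (suc s) (λ i → φ i (s ∸ i))) ≈ ∑ n (λ i → ∑ (n ∸ i) (φ i))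
    ∑-antidiagonals zero    φ = refl
    ∑-antidiagonals (suc n) φ = begin
      ∑ n (λ s → ∑ (suc s) (λ i → φ i (s ∸ i))) + ∑ (suc n) (λ i → φ i (n ∸ i))
        ≈⟨ +-congʳ (∑-antidiagonals n φ) ⟩
      ∑ n (λ i → ∑ (n ∸ i) (φ i)) + ∑ (suc n) (λ i → φ i (n ∸ i))
        ≈⟨ +-congʳ (+-identityʳ _) ⟨
      ∑ n (λ i → ∑ (n ∸ i) (φ i)) + 0# + ∑ (suc n) (λ i → φ i (n ∸ i))
        ≈⟨ +-congʳ (+-congˡ (reflexive (≡.cong (λ m → ∑ m (φ n)) (ℕₚ.n∸n≡0 n)))) ⟨
      ∑ (suc n) (λ i → ∑ (n ∸ i) (φ i)) + ∑ (suc n) (λ i → φ i (n ∸ i))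
        ≈⟨ ∑-+ (suc n) _ _ ⟨
      ∑ (suc n) (λ i → ∑ (n ∸ i) (φ i) + φ i (n ∸ i))
        ≈⟨ ∑-cong< (suc n) (λ i i<1+n →
             reflexive (≡.cong (λ m → ∑ m (φ i)) (≡.sym (ℕₚ.+-∸-assoc 1 (ℕₚ.≤-pred i<1+n))))) ⟩
      ∑ (suc n) (λ i → ∑ (suc n ∸ i) (φ i)) ∎

    ∑-square≈∑-triangle : ∀ d n (φ : ℕ → ℕ → PS k) → d < n → (∀ i j → d < i ℕ.+ j → φ i j ≈ 0#) →
      ∑ n (λ i → ∑ n (φ i)) ≈ ∑ (suc d) (λ i → ∑ (suc (d ∸ i)) (φ i))
    ∑-square≈∑-triangle d n φ d<n φ≈0 = begin
      ∑ n (λ i → ∑ n (φ i))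
        ≈⟨ ∑-splitAt (suc d) n _ d<n ⟩
      ∑ (suc d) (λ i → ∑ n (φ i)) + ∑ (n ∸ suc d) (λ i → ∑ n (φ (suc d ℕ.+ i)))
        ≈⟨ +-cong (∑-cong< (suc d) row) (∑-zero (n ∸ suc d) (λ i _ → ∑-zero n (λ j _ → φ≈0 _ j (far i j)))) ⟩
      ∑ (suc d) (λ i → ∑ (suc (d ∸ i)) (φ i)) + 0#
        ≈⟨ +-identityʳ _ ⟩
      ∑ (suc d) (λ i → ∑ (suc (d ∸ i)) (φ i)) ∎
      where
        far : ∀ i j → d < suc d ℕ.+ i ℕ.+ j
        far i j = ℕₚ.≤-trans (ℕₚ.m≤m+n (suc d) i) (ℕₚ.m≤m+n (suc d ℕ.+ i) j)
        beyond : ∀ i j → i ≤ d → d < i ℕ.+ (suc (d ∸ i) ℕ.+ j)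
        beyond i j i≤d = ℕₚ.≤-trans
          (ℕₚ.≤-reflexive (≡.cong suc (≡.sym (ℕₚ.m+[n∸m]≡n i≤d))))
          (ℕₚ.≤-trans (ℕₚ.≤-reflexive (≡.sym (ℕₚ.+-suc i (d ∸ i))))
                      (ℕₚ.+-monoʳ-≤ i (ℕₚ.m≤m+n (suc (d ∸ i)) j)))
        row : ∀ i → i < suc d → ∑ n (φ i) ≈ ∑ (suc (d ∸ i)) (φ i)
        row i i<1+d = begin
          ∑ n (φ i)
            ≈⟨ ∑-splitAt (suc (d ∸ i)) n (φ i) (ℕₚ.≤-trans (s≤s (ℕₚ.m∸n≤m d i)) d<n) ⟩
          ∑ (suc (d ∸ i)) (φ i) + ∑ (n ∸ suc (d ∸ i)) (λ j → φ i (suc (d ∸ i) ℕ.+ j))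
            ≈⟨ +-congˡ (∑-zero (n ∸ suc (d ∸ i)) (λ j _ → φ≈0 i _ (beyond i j (ℕₚ.≤-pred i<1+d)))) ⟩
          ∑ (suc (d ∸ i)) (φ i) + 0#
            ≈⟨ +-identityʳ _ ⟩
          ∑ (suc (d ∸ i)) (φ i) ∎

    ^-cong : ∀ {x y : PS k} i → x ≈ y → _^ₚ_ {k} x i ≈ _^ₚ_ {k} y i
    ^-cong zero    x≈y = refl
    ^-cong (suc i) x≈y = *-cong x≈y (^-cong i x≈y)

    ^-distribˡ-+-* : ∀ x a b → _^ₚ_ {k} x (a ℕ.+ b) ≈ _^ₚ_ {k} x a * _^ₚ_ {k} x b
    ^-distribˡ-+-* x zero    b = sym (*-identityˡ _)
    ^-distribˡ-+-* x (suc a) b = trans (*-congˡ (^-distribˡ-+-* x a b)) (sym (*-assoc _ _ _))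

    ^-*-assoc : ∀ x a b → _^ₚ_ {k} (_^ₚ_ {k} x a) b ≈ _^ₚ_ {k} x (a ℕ.* b)
    ^-*-assoc x a zero    = reflexive (≡.cong (_^ₚ_ {k} x) (≡.sym (ℕₚ.*-zeroʳ a)))
    ^-*-assoc x a (suc b) = begin
      _^ₚ_ {k} x a * _^ₚ_ {k} (_^ₚ_ {k} x a) b ≈⟨ *-congˡ (^-*-assoc x a b) ⟩
      _^ₚ_ {k} x a * _^ₚ_ {k} x (a ℕ.* b)      ≈⟨ ^-distribˡ-+-* x a (a ℕ.* b) ⟨
      _^ₚ_ {k} x (a ℕ.+ a ℕ.* b)               ≡⟨ ≡.cong (_^ₚ_ {k} x) (≡.sym (ℕₚ.*-suc a b)) ⟩
      _^ₚ_ {k} x (a ℕ.* suc b)                 ∎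

    module Convolution where
      infix 4 _≈′_
      infixl 7 _*′_
      infixl 6 _+′_
      _≈′_ : PS (suc k) → PS (suc k) → Set ℓ
      _≈′_ = _≈ₚ_ {suc k}
      _*′_ : PS (suc k) → PS (suc k) → PS (suc k)
      _*′_ = _*ₚ_ {suc k}
      _+′_ : PS (suc k) → PS (suc k) → PS (suc k)
      _+′_ = _+ₚ_ {suc k}

      *′-comm : ∀ f g → f *′ g ≈′ g *′ f
      *′-comm f g n = begin
        ∑ (suc n) (λ i → f i * g (n ∸ i))             ≈⟨ ∑-reverse (suc n) _ ⟩
        ∑ (suc n) (λ i → f (n ∸ i) * g (n ∸ (n ∸ i))) ≈⟨ ∑-cong< (suc n) swap ⟩
        ∑ (suc n) (λ i → g i * f (n ∸ i))             ∎
        where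
          swap : ∀ i → i < suc n → f (n ∸ i) * g (n ∸ (n ∸ i)) ≈ g i * f (n ∸ i)
          swap i i<1+n = trans (*-comm _ _) (*-congʳ (reflexive (≡.cong g (ℕₚ.m∸[m∸n]≡n (ℕₚ.≤-pred i<1+n)))))

      *′-identityˡ : ∀ g → 1ₚ {suc k} *′ g ≈′ g
      *′-identityˡ g n = begin
        ∑ (suc n) (λ i → 1ₚ {suc k} i * g (n ∸ i))   ≈⟨ ∑-head n _ ⟩
        1# * g n + ∑ n (λ i → 0# * g (n ∸ suc i))    ≈⟨ +-cong (*-identityˡ _) (∑-zero n (λ i _ → zeroˡ _)) ⟩
        g n + 0#                                     ≈⟨ +-identityʳ _ ⟩
        g n                                          ∎

      *′-distribˡ : ∀ f g h → f *′ (g +′ h) ≈′ f *′ g +′ f *′ h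
      *′-distribˡ f g h n = trans (∑-cong (suc n) (λ i → distribˡ (f i) (g (n ∸ i)) (h (n ∸ i)))) (∑-+ (suc n) _ _)

      *′-distribʳ : ∀ f g h → (g +′ h) *′ f ≈′ g *′ f +′ h *′ f
      *′-distribʳ f g h n = trans (∑-cong (suc n) (λ i → distribʳ (f (n ∸ i)) (g i) (h i))) (∑-+ (suc n) _ _)

      *′-cong : ∀ {f f′ g g′} → f ≈′ f′ → g ≈′ g′ → f *′ g ≈′ f′ *′ g′
      *′-cong f≈f′ g≈g′ n = ∑-cong (suc n) (λ i → *-cong (f≈f′ i) (g≈g′ (n ∸ i)))

      *′-assoc : ∀ f g h → (f *′ g) *′ h ≈′ f *′ (g *′ h)
      *′-assoc f g h n = begin
        ∑ (suc n) (λ s → ∑ (suc s) (λ i → f i * g (s ∸ i)) * h (n ∸ s))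
          ≈⟨ ∑-cong (suc n) (λ s → trans (∑-*ʳ (suc s) _ _) (∑-cong< (suc s) (reassoc s))) ⟩
        ∑ (suc n) (λ s → ∑ (suc s) (λ i → φ i (s ∸ i)))
          ≈⟨ ∑-antidiagonals (suc n) φ ⟩
        ∑ (suc n) (λ i → ∑ (suc n ∸ i) (φ i))
          ≈⟨ ∑-cong< (suc n) regroup ⟩
        ∑ (suc n) (λ i → f i * ∑ (suc (n ∸ i)) (λ j → g j * h (n ∸ i ∸ j))) ∎
        where
          φ : ℕ → ℕ → PS k
          φ i j = f i * (g j * h (n ∸ (i ℕ.+ j)))
          reassoc : ∀ s i → i < suc s → f i * g (s ∸ i) * h (n ∸ s) ≈ φ i (s ∸ i)
          reassoc s i i<1+s = trans (*-assoc _ _ _)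
            (*-congˡ (*-congˡ (reflexive (≡.cong (λ m → h (n ∸ m)) (≡.sym (ℕₚ.m+[n∸m]≡n (ℕₚ.≤-pred i<1+s)))))))
          regroup : ∀ i → i < suc n → ∑ (suc n ∸ i) (φ i) ≈ f i * ∑ (suc (n ∸ i)) (λ j → g j * h (n ∸ i ∸ j))
          regroup i i<1+n = begin
            ∑ (suc n ∸ i) (φ i)
              ≡⟨ ≡.cong (λ m → ∑ m (φ i)) (ℕₚ.+-∸-assoc 1 (ℕₚ.≤-pred i<1+n)) ⟩
            ∑ (suc (n ∸ i)) (φ i)
              ≈⟨ ∑-cong (suc (n ∸ i)) (λ j →
                   *-congˡ (*-congˡ (reflexive (≡.cong h (≡.sym (ℕₚ.∸-+-assoc n i j)))))) ⟩
            ∑ (suc (n ∸ i)) (λ j → f i * (g j * h (n ∸ i ∸ j)))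
              ≈⟨ ∑-*ˡ (suc (n ∸ i)) _ _ ⟨
            f i * ∑ (suc (n ∸ i)) (λ j → g j * h (n ∸ i ∸ j)) ∎

      isSeriesRing-suc : IsSeriesRing (suc k)
      isSeriesRing-suc = record
        { isRing = record
          { +-isAbelianGroup = record
            { isGroup = record
              { isMonoid = record
                { isSemigroup = record
                  { isMagma = record
                    { isEquivalence = record
                      { refl = λ n → refl ; sym = λ p n → sym (p n) ; trans = λ p q n → trans (p n) (q n) }
                    ; ∙-cong = λ p q n → +-cong (p n) (q n) }
                  ; assoc = λ f g h n → +-assoc (f n) (g n) (h n) }
                ; identity = (λ f n → +-identityˡ (f n)) , (λ f n → +-identityʳ (f n)) }
              ; inverse = (λ f n → -‿inverseˡ (f n)) , (λ f n → -‿inverseʳ (f n))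
              ; ⁻¹-cong = λ p n → -‿cong (p n) }
            ; comm = λ f g n → +-comm (f n) (g n) }
          ; *-cong = *′-cong
          ; *-assoc = *′-assoc
          ; *-identity = *′-identityˡ , (λ g n → trans (*′-comm g (1ₚ {suc k}) n) (*′-identityˡ g n))
          ; distrib = *′-distribˡ , *′-distribʳ }
        ; *-comm = *′-comm }

  isSeriesRing : ∀ k → IsSeriesRing k
  isSeriesRing zero    = R.isCommutativeRing
  isSeriesRing (suc k) = Layer.Convolution.isSeriesRing-suc k (isSeriesRing k)

  module Series (k : ℕ) = Layer k (isSeriesRing k)

module Coefficient {c ℓ} (R : CommutativeRing c ℓ) where
  open PowerSeries R
  open SeriesRing R
  private module R = CommutativeRing R

  constₚ : ∀ {k} → R.Carrier → PS k
  constₚ {zero}  a         = a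
  constₚ {suc k} a zero    = constₚ {k} a
  constₚ {suc k} a (suc _) = 0ₚ {k}

  coeff-cong : ∀ {k} (m : Vec ℕ k) {A B : PS k} → _≈ₚ_ {k} A B → coeff m A R.≈ coeff m B
  coeff-cong {zero}  []      A≈B = A≈B
  coeff-cong {suc k} (n ∷ m) A≈B = coeff-cong m (A≈B n)

  coeff-+ : ∀ {k} (m : Vec ℕ k) (A B : PS k) → coeff m (_+ₚ_ {k} A B) R.≈ coeff m A R.+ coeff m B
  coeff-+ {zero}  []      A B = R.refl
  coeff-+ {suc k} (n ∷ m) A B = coeff-+ m (A n) (B n)

  coeff-neg : ∀ {k} (m : Vec ℕ k) (A : PS k) → coeff m (-ₚ_ {k} A) R.≈ R.- coeff m A
  coeff-neg {zero}  []      A = R.refl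
  coeff-neg {suc k} (n ∷ m) A = coeff-neg m (A n)

  coeff-0ₚ : ∀ {k} (m : Vec ℕ k) → coeff m (0ₚ {k}) R.≈ R.0#
  coeff-0ₚ {zero}  []      = R.refl
  coeff-0ₚ {suc k} (n ∷ m) = coeff-0ₚ m

  coeff-sumₚ : ∀ {k} (m : Vec ℕ k) M (f : ℕ → PS k) →
    coeff m (sumₚ {k} M f) R.≈ sumₚ {0} M (λ i → coeff m (f i))
  coeff-sumₚ m zero    f = coeff-0ₚ m
  coeff-sumₚ m (suc M) f = R.trans (coeff-+ m _ _) (R.+-congʳ (coeff-sumₚ m M f))

  coeff-build : ∀ {k} (m : Vec ℕ k) (cf : Vec ℕ k → R.Carrier) → coeff m (build cf) ≡ cf m
  coeff-build {zero}  []      cf = ≡.refl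
  coeff-build {suc k} (n ∷ m) cf = coeff-build m (λ m′ → cf (n ∷ m′))

  build-cong : ∀ {k} {cf cg : Vec ℕ k → R.Carrier} → (∀ m → cf m R.≈ cg m) → _≈ₚ_ {k} (build cf) (build cg)
  build-cong {zero}  cf≈cg = cf≈cg []
  build-cong {suc k} cf≈cg n = build-cong (λ m → cf≈cg (n ∷ m))

  coeff-constₚ-* : ∀ {k} (m : Vec ℕ k) a (A : PS k) → coeff m (_*ₚ_ {k} (constₚ {k} a) A) R.≈ a R.* coeff m A
  coeff-constₚ-* {zero}  []      a A = R.refl
  coeff-constₚ-* {suc k} (n ∷ m) a A = R.trans (coeff-cong m onlyHead) (coeff-constₚ-* m a (A n))
    where
      open Series k
      onlyHead : ∑ (suc n) (λ i → constₚ {suc k} a i * A (n ∸ i)) ≈ constₚ {k} a * A n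
      onlyHead = trans (∑-head n _) (trans (+-congˡ (∑-zero n (λ i _ → zeroˡ _))) (+-identityʳ _))

module Order {c ℓ} (R : CommutativeRing c ℓ) where
  open PowerSeries R
  open SeriesRing R
  open Coefficient R
  private module R = CommutativeRing R

  -- Ord≥ t A: every coefficient of A of total degree below t vanishes.
  Ord≥ : ∀ {k} → ℕ → PS k → Set ℓ
  Ord≥ {zero}  t a = 0 < t → a R.≈ R.0#
  Ord≥ {suc k} t f = ∀ n → Ord≥ {k} (t ∸ n) (f n)

  Ord≥-mono : ∀ {k} {s t} (A : PS k) → s ≤ t → Ord≥ {k} t A → Ord≥ {k} s A
  Ord≥-mono {zero}  A s≤t A≥t 0<s = A≥t (ℕₚ.<-≤-trans 0<s s≤t)
  Ord≥-mono {suc k} A s≤t A≥t n   = Ord≥-mono (A n) (ℕₚ.∸-monoˡ-≤ n s≤t) (A≥t n)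

  Ord≥0 : ∀ {k} (A : PS k) → Ord≥ {k} 0 A
  Ord≥0 {zero}  A ()
  Ord≥0 {suc k} A n = ≡.subst (λ t → Ord≥ {k} t (A n)) (≡.sym (ℕₚ.0∸n≡0 n)) (Ord≥0 (A n))

  Ord≥-0ₚ : ∀ {k} t → Ord≥ {k} t (0ₚ {k})
  Ord≥-0ₚ {zero}  t _ = R.refl
  Ord≥-0ₚ {suc k} t n = Ord≥-0ₚ (t ∸ n)

  Ord≥-+ : ∀ {k} {t} {A B : PS k} → Ord≥ {k} t A → Ord≥ {k} t B → Ord≥ {k} t (_+ₚ_ {k} A B)
  Ord≥-+ {zero}  A≥t B≥t 0<t = R.trans (R.+-cong (A≥t 0<t) (B≥t 0<t)) (R.+-identityˡ R.0#)
  Ord≥-+ {suc k} A≥t B≥t n   = Ord≥-+ (A≥t n) (B≥t n)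

  Ord≥-sumₚ : ∀ {k} {t} M (f : ℕ → PS k) → (∀ i → i < M → Ord≥ {k} t (f i)) → Ord≥ {k} t (sumₚ {k} M f)
  Ord≥-sumₚ {k} {t} zero f _ = Ord≥-0ₚ t
  Ord≥-sumₚ (suc M) f f≥t = Ord≥-+ (Ord≥-sumₚ M f (λ i i<M → f≥t i (ℕₚ.m<n⇒m<1+n i<M))) (f≥t M ℕₚ.≤-refl)

  private
    ∸-+-≤ : ∀ a b x y → (a ℕ.+ b) ∸ (x ℕ.+ y) ≤ (a ∸ x) ℕ.+ (b ∸ y)
    ∸-+-≤ a       b       zero    zero    = ℕₚ.≤-refl
    ∸-+-≤ zero    b       (suc x) y       = ℕₚ.∸-monoʳ-≤ b (ℕₚ.m≤n+m y (suc x))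
    ∸-+-≤ (suc a) b       (suc x) y       = ∸-+-≤ a b x y
    ∸-+-≤ a       zero    zero    (suc y) rewrite ℕₚ.+-identityʳ a = ℕₚ.m∸n≤m a (suc y)
    ∸-+-≤ a       (suc b) zero    (suc y) rewrite ℕₚ.+-suc a b     = ∸-+-≤ a b zero y

  Ord≥-* : ∀ {k} {s t} {A B : PS k} → Ord≥ {k} s A → Ord≥ {k} t B → Ord≥ {k} (s ℕ.+ t) (_*ₚ_ {k} A B)
  Ord≥-* {zero}  {zero}  {t} A≥s B≥t 0<t = R.trans (R.*-congˡ (B≥t 0<t)) (R.zeroʳ _)
  Ord≥-* {zero}  {suc s}     A≥s B≥t _   = R.trans (R.*-congʳ (A≥s (s≤s z≤n))) (R.zeroˡ _)
  Ord≥-* {suc k} {s}     {t} A≥s B≥t n   =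
    Ord≥-sumₚ (suc n) _ (λ i i<1+n → Ord≥-mono _ (split i (ℕₚ.≤-pred i<1+n)) (Ord≥-* {k} (A≥s i) (B≥t (n ∸ i))))
    where
      split : ∀ i → i ≤ n → (s ℕ.+ t) ∸ n ≤ (s ∸ i) ℕ.+ (t ∸ (n ∸ i))
      split i i≤n = ≡.subst (λ m → (s ℕ.+ t) ∸ m ≤ (s ∸ i) ℕ.+ (t ∸ (n ∸ i)))
        (ℕₚ.m+[n∸m]≡n i≤n) (∸-+-≤ s t i (n ∸ i))

  Ord≥-^ : ∀ {k} {A : PS k} → Ord≥ {k} 1 A → ∀ i → Ord≥ {k} i (_^ₚ_ {k} A i)
  Ord≥-^ {k} A≥1 zero    = Ord≥0 {k} _
  Ord≥-^ {k} A≥1 (suc i) = Ord≥-* {k} A≥1 (Ord≥-^ {k} A≥1 i)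

  Ord≥⇒coeff≈0 : ∀ {k} {t} {A : PS k} → Ord≥ {k} t A → ∀ (m : Vec ℕ k) → totalDegree m < t → coeff m A R.≈ R.0#
  Ord≥⇒coeff≈0 {zero}  A≥t []      deg<t = A≥t deg<t
  Ord≥⇒coeff≈0 {suc k} {t} A≥t (n ∷ m) deg<t =
    Ord≥⇒coeff≈0 {k} (A≥t n) m (ℕₚ.m+n≤o⇒m≤o∸n (suc (totalDegree m))
      (≡.subst (_≤ t) (≡.cong suc (ℕₚ.+-comm n (totalDegree m))) deg<t))

  coeff≈0⇒Ord≥ : ∀ {k} t (A : PS k) → (∀ (m : Vec ℕ k) → totalDegree m < t → coeff m A R.≈ R.0#) → Ord≥ {k} t A
  coeff≈0⇒Ord≥ {zero}  t A low≈0 0<t = low≈0 [] 0<t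
  coeff≈0⇒Ord≥ {suc k} t A low≈0 n   =
    coeff≈0⇒Ord≥ {k} (t ∸ n) (A n) (λ m deg<t∸n → low≈0 (n ∷ m) (lift m deg<t∸n))
    where
      lift : ∀ m → totalDegree m < t ∸ n → n ℕ.+ totalDegree m < t
      lift m deg<t∸n with n ≤? t
      ... | yes n≤t = ℕₚ.≤-trans (ℕₚ.≤-reflexive (≡.sym (ℕₚ.+-suc n (totalDegree m))))
                        (ℕₚ.≤-trans (ℕₚ.+-monoʳ-≤ n deg<t∸n) (ℕₚ.≤-reflexive (ℕₚ.m+[n∸m]≡n n≤t)))
      ... | no n≰t
        with () ← ≡.subst (suc (totalDegree m) ≤_) (ℕₚ.m≤n⇒m∸n≡0 (ℕₚ.<⇒≤ (ℕₚ.≰⇒> n≰t))) deg<t∸n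

  Ord≥1⇒const≈0 : ∀ {g : PS 1} → Ord≥ {1} 1 g → g 0 R.≈ R.0#
  Ord≥1⇒const≈0 g≥1 = g≥1 0 (s≤s z≤n)

  Ord≥1-var : ∀ {k} (i : Fin k) → Ord≥ {k} 1 (var {k} i)
  Ord≥1-var {suc k} Fin.zero    zero          = Ord≥-0ₚ 1
  Ord≥1-var {suc k} Fin.zero    (suc zero)    = Ord≥0 (1ₚ {k})
  Ord≥1-var {suc k} Fin.zero    (suc (suc n)) = Ord≥-0ₚ 0
  Ord≥1-var {suc k} (Fin.suc i) zero          = Ord≥1-var i
  Ord≥1-var {suc k} (Fin.suc i) (suc n)       = Ord≥-0ₚ _

module Composition {c ℓ} (R : CommutativeRing c ℓ) where
  open PowerSeries R
  open SeriesRing R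
  open Coefficient R
  open Order R
  private
    module R = CommutativeRing R
    module PS₀ = Series 0

  composeBelow : ∀ {k} → ℕ → PS 2 → PS k → PS k → PS k
  composeBelow {k} M F A B = sumₚ {k} M λ i → sumₚ {k} M λ j →
    _*ₚ_ {k} (constₚ {k} (F i j)) (_*ₚ_ {k} (_^ₚ_ {k} A i) (_^ₚ_ {k} B j))

  coeff-composeBelow : ∀ {k} M F (A B : PS k) (m : Vec ℕ k) →
    coeff m (composeBelow {k} M F A B) R.≈
    sumₚ {0} M (λ i → sumₚ {0} M (λ j → F i j R.* coeff m (_*ₚ_ {k} (_^ₚ_ {k} A i) (_^ₚ_ {k} B j))))
  coeff-composeBelow M F A B m = R.trans (coeff-sumₚ m M _) (PS₀.∑-cong M (λ i →
    R.trans (coeff-sumₚ m M _) (PS₀.∑-cong M (λ j → coeff-constₚ-* m _ _))))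

  coeff-compose≈coeff-composeBelow : ∀ {k} F (A B : PS k) → Ord≥ {k} 1 A → Ord≥ {k} 1 B →
    ∀ M (m : Vec ℕ k) → totalDegree m < M → coeff m (compose {k} F A B) R.≈ coeff m (composeBelow {k} M F A B)
  coeff-compose≈coeff-composeBelow {k} F A B A≥1 B≥1 M m deg<M = begin
    coeff m (compose {k} F A B)
      ≡⟨ coeff-build m _ ⟩
    PS₀.∑ (suc d) (λ i → PS₀.∑ (suc (d ∸ i)) (term i))
      ≈⟨ PS₀.∑-square≈∑-triangle d M term deg<M high≈0 ⟨
    PS₀.∑ M (λ i → PS₀.∑ M (term i))
      ≈⟨ coeff-composeBelow M F A B m ⟨
    coeff m (composeBelow {k} M F A B) ∎
    where
      open import Relation.Binary.Reasoning.Setoid R.setoid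
      d : ℕ
      d = totalDegree m
      term : ℕ → ℕ → R.Carrier
      term i j = F i j R.* coeff m (_*ₚ_ {k} (_^ₚ_ {k} A i) (_^ₚ_ {k} B j))
      high≈0 : ∀ i j → d < i ℕ.+ j → term i j R.≈ R.0#
      high≈0 i j d<i+j = R.trans (R.*-congˡ AⁱBʲ≈0) (R.zeroʳ _)
        where
          AⁱBʲ≈0 = Ord≥⇒coeff≈0 {k} (Ord≥-* {k} (Ord≥-^ {k} A≥1 i) (Ord≥-^ {k} B≥1 j)) m d<i+j

  Ord≥1-compose : ∀ {k} F {A B : PS k} → constTerm {2} F R.≈ R.0# →
    Ord≥ {k} 1 A → Ord≥ {k} 1 B → Ord≥ {k} 1 (compose {k} F A B)
  Ord≥1-compose {k} F {A} {B} F₀₀≈0 A≥1 B≥1 = coeff≈0⇒Ord≥ {k} 1 _ λ m deg<1 → begin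
    coeff m (compose {k} F A B)                                ≈⟨ coeff-compose≈coeff-composeBelow F A B A≥1 B≥1 1 m deg<1 ⟩
    coeff m (composeBelow {k} 1 F A B)                         ≈⟨ coeff-composeBelow 1 F A B m ⟩
    R.0# R.+ (R.0# R.+ F 0 0 R.* coeff m (_*ₚ_ {k} (1ₚ {k}) (1ₚ {k}))) ≈⟨ R.trans (R.+-identityˡ _) (R.+-identityˡ _) ⟩
    F 0 0 R.* coeff m (_*ₚ_ {k} (1ₚ {k}) (1ₚ {k}))            ≈⟨ R.trans (R.*-congʳ F₀₀≈0) (R.zeroˡ _) ⟩
    R.0#                                                       ∎
    where open import Relation.Binary.Reasoning.Setoid R.setoid

  compose-cong : ∀ {k} F {A A′ B B′ : PS k} → _≈ₚ_ {k} A A′ → _≈ₚ_ {k} B B′ →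
    _≈ₚ_ {k} (compose {k} F A B) (compose {k} F A′ B′)
  compose-cong {k} F {A} {A′} {B} {B′} A≈A′ B≈B′ = build-cong {k} λ m →
    PS₀.∑-cong (suc (totalDegree m)) λ i → PS₀.∑-cong (suc (totalDegree m ∸ i)) λ j →
      R.*-congˡ (coeff-cong m (PSₖ.*-cong (PSₖ.^-cong i A≈A′) (PSₖ.^-cong j B≈B′)))
    where module PSₖ = Series k

-- Series in two variables are read as series in an outer variable over R[[τ]],
-- and eval e E substitutes e for that outer variable.
module Evaluation {c ℓ} (R : CommutativeRing c ℓ) where
  open PowerSeries R
  open SeriesRing R
  open Coefficient R
  open Order R
  private
    module R = CommutativeRing R
    module PS₀ = Series 0
  open Series 1 using (_≈_; _+_; _*_; 0#; ∑)
  private module PS₁ = Series 1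

  infixr 8 _^_
  _^_ : PS 1 → ℕ → PS 1
  _^_ = _^ₚ_ {1}

  Ord≥₁⇒≈0 : ∀ {t} {A : PS 1} → Ord≥ {1} t A → ∀ n → n < t → A n R.≈ R.0#
  Ord≥₁⇒≈0 A≥t n n<t = Ord≥⇒coeff≈0 {1} A≥t (n ∷ []) (≡.subst (_< _) (≡.sym (ℕₚ.+-identityʳ n)) n<t)

  *-coeff-cong≤ : ∀ {n A A′ B B′} → (∀ s → s ≤ n → A s R.≈ A′ s) → (∀ s → s ≤ n → B s R.≈ B′ s) →
    (A * B) n R.≈ (A′ * B′) n
  *-coeff-cong≤ {n} A≈A′ B≈B′ = PS₀.∑-cong< (suc n) λ i i<1+n →
    R.*-cong (A≈A′ i (ℕₚ.≤-pred i<1+n)) (B≈B′ (n ∸ i) (ℕₚ.m∸n≤m n i))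

  shift : ℕ → PS 1 → PS 1
  shift zero    E n       = E n
  shift (suc a) E zero    = R.0#
  shift (suc a) E (suc n) = shift a E n

  shift-cong : ∀ a {E E′} → E ≈ E′ → shift a E ≈ shift a E′
  shift-cong zero    E≈E′ n       = E≈E′ n
  shift-cong (suc a) E≈E′ zero    = R.refl
  shift-cong (suc a) E≈E′ (suc n) = shift-cong a E≈E′ n

  shift-below : ∀ a E n → n < a → shift a E n ≡ R.0#
  shift-below (suc a) E zero    _         = ≡.refl
  shift-below (suc a) E (suc n) (s≤s n<a) = shift-below a E n n<a

  shift-+ : ∀ a E s → shift a E (a ℕ.+ s) ≡ E s
  shift-+ zero    E s = ≡.refl
  shift-+ (suc a) E s = shift-+ a E s

  X₁*≈shift1 : ∀ E → X₁ * E ≈ shift 1 E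
  X₁*≈shift1 E zero    = R.trans (R.+-identityˡ _) (R.zeroˡ _)
  X₁*≈shift1 E (suc n) = begin
    PS₀.∑ (suc (suc n)) (λ i → X₁ i R.* E (suc n ∸ i))
      ≈⟨ PS₀.∑-head (suc n) _ ⟩
    R.0# R.* E (suc n) R.+ PS₀.∑ (suc n) (λ i → X₁ (suc i) R.* E (n ∸ i))
      ≈⟨ R.+-cong (R.zeroˡ _) (PS₀.∑-head n _) ⟩
    R.0# R.+ (R.1# R.* E n R.+ PS₀.∑ n (λ i → R.0# R.* E (n ∸ suc i)))
      ≈⟨ R.+-identityˡ _ ⟩
    R.1# R.* E n R.+ PS₀.∑ n (λ i → R.0# R.* E (n ∸ suc i))
      ≈⟨ R.+-cong (R.*-identityˡ _) (PS₀.∑-zero n (λ i _ → R.zeroˡ _)) ⟩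
    E n R.+ R.0#
      ≈⟨ R.+-identityʳ _ ⟩
    E n ∎
    where open import Relation.Binary.Reasoning.Setoid R.setoid

  X₁^*≈shift : ∀ a E → X₁ ^ a * E ≈ shift a E
  X₁^*≈shift zero    E = PS₁.*-identityˡ E
  X₁^*≈shift (suc a) E = begin
    X₁ * X₁ ^ a * E     ≈⟨ PS₁.*-assoc X₁ (X₁ ^ a) E ⟩
    X₁ * (X₁ ^ a * E)   ≈⟨ PS₁.*-congˡ (X₁^*≈shift a E) ⟩
    X₁ * shift a E      ≈⟨ X₁*≈shift1 (shift a E) ⟩
    shift 1 (shift a E) ≈⟨ shift1∘shift ⟩
    shift (suc a) E     ∎
    where
      open import Relation.Binary.Reasoning.Setoid PS₁.setoid
      shift1∘shift : shift 1 (shift a E) ≈ shift (suc a) E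
      shift1∘shift zero    = R.refl
      shift1∘shift (suc n) = R.refl

  eval : PS 1 → PS 2 → PS 1
  eval e E n = PS₀.∑ (suc n) (λ p → (e ^ p * E p) n)

  evalBelow : ℕ → PS 1 → PS 2 → PS 1
  evalBelow M e E = ∑ M (λ p → e ^ p * E p)

  eval≈evalBelow : ∀ {e} E → Ord≥ {1} 1 e → ∀ {n M} → n < M → eval e E n R.≈ evalBelow M e E n
  eval≈evalBelow {e} E e≥1 {n} {M} n<M = R.sym (begin
    evalBelow M e E n
      ≈⟨ coeff-sumₚ (n ∷ []) M _ ⟩
    PS₀.∑ M (λ p → (e ^ p * E p) n)
      ≈⟨ PS₀.∑-splitAt (suc n) M _ n<M ⟩
    eval e E n R.+ PS₀.∑ (M ∸ suc n) (λ i → (e ^ (suc n ℕ.+ i) * E (suc n ℕ.+ i)) n)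
      ≈⟨ R.+-congˡ (PS₀.∑-zero (M ∸ suc n) (λ i _ → high≈0 i)) ⟩
    eval e E n R.+ R.0#
      ≈⟨ R.+-identityʳ _ ⟩
    eval e E n ∎)
    where
      open import Relation.Binary.Reasoning.Setoid R.setoid
      high≈0 : ∀ i → (e ^ (suc n ℕ.+ i) * E (suc n ℕ.+ i)) n R.≈ R.0#
      high≈0 i = Ord≥₁⇒≈0 (Ord≥-* {1} (Ord≥-^ {1} e≥1 (suc n ℕ.+ i)) (Ord≥0 {1} (E (suc n ℕ.+ i)))) n
        (≡.subst (n <_) (≡.sym (ℕₚ.+-identityʳ _)) (ℕₚ.m≤m+n (suc n) i))

  eval-cong : ∀ e {E G : PS 2} → _≈ₚ_ {2} E G → eval e E ≈ eval e G
  eval-cong e E≈G n = PS₀.∑-cong (suc n) (λ p → PS₁.*-congˡ (E≈G p) n)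

  eval-+ : ∀ e (E G : PS 2) → eval e (_+ₚ_ {2} E G) ≈ eval e E + eval e G
  eval-+ e E G n = R.trans (PS₀.∑-cong (suc n) (λ p → PS₁.distribˡ (e ^ p) (E p) (G p) n)) (PS₀.∑-+ (suc n) _ _)

  eval-const : ∀ e (E : PS 2) → (∀ p → E (suc p) ≈ 0#) → eval e E ≈ E 0
  eval-const e E E₊≈0 n = R.trans (PS₀.∑-head n _) (R.trans
    (R.+-cong (PS₁.*-identityˡ (E 0) n) (PS₀.∑-zero n (λ p _ → PS₁.trans (PS₁.*-congˡ (E₊≈0 p)) (PS₁.zeroʳ _) n)))
    (R.+-identityʳ _))

  Ord≥-eval : ∀ {e} (E : PS 2) t → Ord≥ {1} 1 e → (∀ p → Ord≥ {1} (t ∸ p) (E p)) → Ord≥ {1} t (eval e E)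
  Ord≥-eval E t e≥1 E≥t n 0<t∸n = PS₀.∑-zero (suc n) λ p _ →
    Ord≥₁⇒≈0 (Ord≥-* {1} (Ord≥-^ {1} e≥1 p) (E≥t p)) n (ℕₚ.<-≤-trans n<t (ℕₚ.m≤n+m∸n t p))
    where
      n<t : n < t
      n<t = ℕₚ.∸-cancelʳ-< {t} {n} {t} (≡.subst (_< t ∸ n) (≡.sym (ℕₚ.n∸n≡0 t)) 0<t∸n)

  crossTerm : PS 1 → PS 2 → PS 2 → ℕ → ℕ → PS 1
  crossTerm e E G i j = (e ^ i * E i) * (e ^ j * G j)

  evalBelow*evalBelow : ∀ e (E G : PS 2) M n →
    (evalBelow M e E * evalBelow M e G) n R.≈ PS₀.∑ M (λ i → PS₀.∑ M (λ j → crossTerm e E G i j n))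
  evalBelow*evalBelow e E G M n = R.trans
    (PS₁.trans (PS₁.∑-*ʳ M (evalBelow M e G) (λ i → e ^ i * E i))
               (PS₁.∑-cong M (λ i → PS₁.∑-*ˡ M (e ^ i * E i) (λ j → e ^ j * G j))) n)
    (R.trans (coeff-sumₚ (n ∷ []) M _) (PS₀.∑-cong M (λ i → coeff-sumₚ (n ∷ []) M (crossTerm e E G i))))

  ^-*ₚ-antidiagonal : ∀ e (E G : PS 2) s → e ^ s * _*ₚ_ {2} E G s ≈ ∑ (suc s) (λ i → crossTerm e E G i (s ∸ i))
  ^-*ₚ-antidiagonal e E G s =
    PS₁.trans (PS₁.∑-*ˡ (suc s) (e ^ s) (λ i → E i * G (s ∸ i))) (PS₁.∑-cong< (suc s) λ i i<1+s →
    PS₁.trans (PS₁.*-congʳ {E i * G (s ∸ i)} (PS₁.trans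
        (PS₁.reflexive (≡.cong (e ^_) (≡.sym (ℕₚ.m+[n∸m]≡n (ℕₚ.≤-pred i<1+s)))))
        (PS₁.^-distribˡ-+-* e i (s ∸ i))))
      (PS₁.*-interchange (e ^ i) (e ^ (s ∸ i)) (E i) (G (s ∸ i))))

  evalBelow-*ₚ : ∀ {e} (E G : PS 2) → Ord≥ {1} 1 e → ∀ n →
    evalBelow (suc n) e (_*ₚ_ {2} E G) n R.≈ PS₀.∑ (suc n) (λ i → PS₀.∑ (suc n) (λ j → crossTerm e E G i j n))
  evalBelow-*ₚ {e} E G e≥1 n = begin
    evalBelow M e (_*ₚ_ {2} E G) n
      ≈⟨ PS₁.trans (PS₁.∑-cong M (^-*ₚ-antidiagonal e E G)) (PS₁.∑-antidiagonals M (crossTerm e E G)) n ⟩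
    ∑ M (λ i → ∑ (M ∸ i) (crossTerm e E G i)) n
      ≈⟨ coeff-sumₚ (n ∷ []) M _ ⟩
    PS₀.∑ M (λ i → ∑ (M ∸ i) (crossTerm e E G i) n)
      ≈⟨ PS₀.∑-cong< M row ⟩
    PS₀.∑ M (λ i → PS₀.∑ (suc (n ∸ i)) (term i))
      ≈⟨ PS₀.∑-square≈∑-triangle n M term ℕₚ.≤-refl high≈0 ⟨
    PS₀.∑ M (λ i → PS₀.∑ M (term i)) ∎
    where
      open import Relation.Binary.Reasoning.Setoid R.setoid
      M : ℕ
      M = suc n
      term : ℕ → ℕ → R.Carrier
      term i j = crossTerm e E G i j n
      row : ∀ i → i < M → ∑ (M ∸ i) (crossTerm e E G i) n R.≈ PS₀.∑ (suc (n ∸ i)) (term i)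
      row i i<M = R.trans (coeff-sumₚ (n ∷ []) (M ∸ i) (crossTerm e E G i))
        (R.reflexive (≡.cong (λ m → PS₀.∑ m (term i)) (ℕₚ.+-∸-assoc 1 (ℕₚ.≤-pred i<M))))
      high≈0 : ∀ i j → n < i ℕ.+ j → term i j R.≈ R.0#
      high≈0 i j n<i+j = Ord≥₁⇒≈0
        (Ord≥-* {1} (Ord≥-* {1} (Ord≥-^ {1} e≥1 i) (Ord≥0 {1} (E i)))
                    (Ord≥-* {1} (Ord≥-^ {1} e≥1 j) (Ord≥0 {1} (G j)))) n
        (≡.subst (n <_) (≡.sym (≡.cong₂ ℕ._+_ (ℕₚ.+-identityʳ i) (ℕₚ.+-identityʳ j))) n<i+j)

  eval-* : ∀ {e} (E G : PS 2) → Ord≥ {1} 1 e → eval e (_*ₚ_ {2} E G) ≈ eval e E * eval e G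
  eval-* {e} E G e≥1 n = begin
    eval e (_*ₚ_ {2} E G) n                              ≈⟨ eval≈evalBelow (_*ₚ_ {2} E G) e≥1 ℕₚ.≤-refl ⟩
    evalBelow M e (_*ₚ_ {2} E G) n                       ≈⟨ evalBelow-*ₚ E G e≥1 n ⟩
    PS₀.∑ M (λ i → PS₀.∑ M (λ j → crossTerm e E G i j n)) ≈⟨ evalBelow*evalBelow e E G M n ⟨
    (evalBelow M e E * evalBelow M e G) n                ≈⟨ *-coeff-cong≤ (below E) (below G) ⟨
    (eval e E * eval e G) n                              ∎
    where
      open import Relation.Binary.Reasoning.Setoid R.setoid
      M : ℕ
      M = suc n
      below : ∀ H s → s ≤ n → eval e H s R.≈ evalBelow M e H s
      below H s s≤n = eval≈evalBelow H e≥1 (s≤s s≤n)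

  eval-X₁^ : ∀ W (E : PS 2) n → eval (X₁ ^ W) E n R.≈ PS₀.∑ (suc n) (λ q → shift (W ℕ.* q) (E q) n)
  eval-X₁^ W E n = PS₀.∑-cong (suc n) λ q →
    PS₁.trans (PS₁.*-congʳ {E q} (PS₁.^-*-assoc X₁ W q)) (X₁^*≈shift (W ℕ.* q) (E q)) n

-- Kronecker substitution: the outer variable of PS (suc k) goes to τ^(N^k), so the
-- monomial X₀^a₀ ⋯ X_{k-1}^a_{k-1} goes to τ^(a₀ N^(k-1) + ⋯ + a_{k-1}).
module Kronecker {c ℓ} (R : CommutativeRing c ℓ) (N : ℕ) (1≤N : 1 ≤ N) where
  open PowerSeries R
  open SeriesRing R
  open Coefficient R
  open Order R
  open Composition R
  open Evaluation R
  private
    module R = CommutativeRing R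
    module PS₁ = Series 1
  open PS₁ using (_≈_; _+_; _*_; 0#; 1#)

  kron : ∀ {k} → PS k → PS 1
  kron {zero}  a = constₚ {1} a
  kron {suc k} D = eval (X₁ ^ (N ℕ.^ k)) (λ p → kron {k} (D p))

  1≤N^ : ∀ k → 1 ≤ N ℕ.^ k
  1≤N^ = ℕₚ.m^n>0 N {{ℕ.>-nonZero 1≤N}}

  Ord≥1-X₁^N^ : ∀ k → Ord≥ {1} 1 (X₁ ^ (N ℕ.^ k))
  Ord≥1-X₁^N^ k = Ord≥-mono {1} _ (1≤N^ k) (Ord≥-^ {1} (Ord≥1-var {1} Fin.zero) (N ℕ.^ k))

  record IsKronHom (k : ℕ) : Set (c ⊔ ℓ) where
    field
      cong            : ∀ {A B : PS k} → _≈ₚ_ {k} A B → kron {k} A ≈ kron {k} B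
      +-homo          : ∀ (A B : PS k) → kron {k} (_+ₚ_ {k} A B) ≈ kron {k} A + kron {k} B
      0#-homo         : kron {k} (0ₚ {k}) ≈ 0#
      1#-homo         : kron {k} (1ₚ {k}) ≈ 1#
      *-homo          : ∀ (A B : PS k) → kron {k} (_*ₚ_ {k} A B) ≈ kron {k} A * kron {k} B
      constₚ-homo     : ∀ a → kron {k} (constₚ {k} a) ≈ constₚ {1} a
      Ord≥-preserving : ∀ t (A : PS k) → Ord≥ {k} t A → Ord≥ {1} t (kron {k} A)

    sumₚ-homo : ∀ M (f : ℕ → PS k) → kron {k} (sumₚ {k} M f) ≈ PS₁.∑ M (λ i → kron {k} (f i))
    sumₚ-homo zero    f = 0#-homo
    sumₚ-homo (suc M) f = PS₁.trans (+-homo (sumₚ {k} M f) (f M)) (PS₁.+-congʳ (sumₚ-homo M f))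

    ^-homo : ∀ (A : PS k) i → kron {k} (_^ₚ_ {k} A i) ≈ kron {k} A ^ i
    ^-homo A zero    = 1#-homo
    ^-homo A (suc i) = PS₁.trans (*-homo A (_^ₚ_ {k} A i)) (PS₁.*-congˡ (^-homo A i))

    -‿homo : ∀ (A : PS k) → kron {k} (-ₚ_ {k} A) ≈ PS₁.- kron {k} A
    -‿homo A = inverseʳ-unique (kron {k} A) (kron {k} (-ₚ_ {k} A)) (begin
      kron {k} A + kron {k} (-ₚ_ {k} A) ≈⟨ +-homo A (-ₚ_ {k} A) ⟨
      kron {k} (_+ₚ_ {k} A (-ₚ_ {k} A)) ≈⟨ cong (Series.-‿inverseʳ k A) ⟩
      kron {k} (0ₚ {k})                 ≈⟨ 0#-homo ⟩
      0#                                ∎)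
      where
        open import Algebra.Properties.Group PS₁.+-group using (inverseʳ-unique)
        open import Relation.Binary.Reasoning.Setoid PS₁.setoid

  kron₀-isKronHom : IsKronHom 0
  kron₀-isKronHom = record
    { cong            = λ { a≈b zero → a≈b ; a≈b (suc n) → R.refl }
    ; +-homo          = λ { a b zero → R.refl ; a b (suc n) → R.sym (R.+-identityˡ R.0#) }
    ; 0#-homo         = λ { zero → R.refl ; (suc n) → R.refl }
    ; 1#-homo         = λ { zero → R.refl ; (suc n) → R.refl }
    ; *-homo          = λ a b n → R.sym (R.trans (coeff-constₚ-* (n ∷ []) a (constₚ {1} b)) (scale a b n))
    ; constₚ-homo     = λ { a zero → R.refl ; a (suc n) → R.refl }
    ; Ord≥-preserving = λ { t a a≥t zero → a≥t ; t a a≥t (suc n) → λ _ → R.refl }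
    }
    where
      scale : ∀ a b n → a R.* constₚ {1} b n R.≈ constₚ {1} (a R.* b) n
      scale a b zero    = R.refl
      scale a b (suc n) = R.zeroʳ a

  kron-suc-isKronHom : ∀ {k} → IsKronHom k → IsKronHom (suc k)
  kron-suc-isKronHom {k} hom = record
    { cong            = λ {A} {B} A≈B → eval-cong e {coeffs A} {coeffs B} (λ p → H.cong (A≈B p))
    ; +-homo          = λ A B → PS₁.trans
        (eval-cong e {coeffs (_+ₚ_ {suc k} A B)} {_+ₚ_ {2} (coeffs A) (coeffs B)} (λ p → H.+-homo (A p) (B p)))
        (eval-+ e (coeffs A) (coeffs B))
    ; 0#-homo         = PS₁.trans (eval-cong e {coeffs (0ₚ {suc k})} {0ₚ {2}} (λ p → H.0#-homo))
                                  (eval-const e (0ₚ {2}) (λ p → PS₁.refl))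
    ; 1#-homo         = PS₁.trans (eval-const e (coeffs (1ₚ {suc k})) (λ p → H.0#-homo)) H.1#-homo
    ; *-homo          = λ A B → PS₁.trans
        (eval-cong e {coeffs (_*ₚ_ {suc k} A B)} {_*ₚ_ {2} (coeffs A) (coeffs B)} λ p → PS₁.trans
          (H.sumₚ-homo (suc p) (λ i → _*ₚ_ {k} (A i) (B (p ∸ i))))
          (PS₁.∑-cong (suc p) (λ i → H.*-homo (A i) (B (p ∸ i)))))
        (eval-* (coeffs A) (coeffs B) (Ord≥1-X₁^N^ k))
    ; constₚ-homo     = λ a → PS₁.trans (eval-const e (coeffs (constₚ {suc k} a)) (λ p → H.0#-homo)) (H.constₚ-homo a)
    ; Ord≥-preserving = λ t A A≥t →
        Ord≥-eval (coeffs A) t (Ord≥1-X₁^N^ k) (λ p → H.Ord≥-preserving (t ∸ p) (A p) (A≥t p))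
    }
    where
      module H = IsKronHom hom
      e : PS 1
      e = X₁ ^ (N ℕ.^ k)
      coeffs : PS (suc k) → PS 2
      coeffs D p = kron {k} (D p)

  kron-isKronHom : ∀ k → IsKronHom k
  kron-isKronHom zero    = kron₀-isKronHom
  kron-isKronHom (suc k) = kron-suc-isKronHom (kron-isKronHom k)

  module _ {k : ℕ} where
    open IsKronHom (kron-isKronHom k)

    kron-agree : ∀ t (A B : PS k) → (∀ m → totalDegree m < t → coeff m A R.≈ coeff m B) →
      ∀ n → n < t → kron {k} A n R.≈ kron {k} B n
    kron-agree t A B A≈B n n<t = x∙y⁻¹≈ε⇒x≈y (kron {k} A n) (kron {k} B n) (begin
      kron {k} A n R.+ R.- kron {k} B n        ≈⟨ PS₁.trans (+-homo A (-ₚ_ {k} B)) (PS₁.+-congˡ (-‿homo B)) n ⟨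
      kron {k} (_+ₚ_ {k} A (-ₚ_ {k} B)) n      ≈⟨ Ord≥₁⇒≈0 (Ord≥-preserving t _ difference≥t) n n<t ⟩
      R.0#                                      ∎)
      where
        open import Algebra.Properties.Group R.+-group using (x∙y⁻¹≈ε⇒x≈y)
        open import Relation.Binary.Reasoning.Setoid R.setoid
        difference≥t : Ord≥ {k} t (_+ₚ_ {k} A (-ₚ_ {k} B))
        difference≥t = coeff≈0⇒Ord≥ {k} t _ λ m deg<t →
          R.trans (coeff-+ m A (-ₚ_ {k} B)) (R.trans (R.+-congˡ (coeff-neg m B))
            (R.trans (R.+-congʳ (A≈B m deg<t)) (R.-‿inverseʳ _)))

    kron-composeBelow : ∀ M F (A B : PS k) →
      kron {k} (composeBelow {k} M F A B) ≈ composeBelow {1} M F (kron {k} A) (kron {k} B)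
    kron-composeBelow M F A B =
      PS₁.trans (sumₚ-homo M _) (PS₁.∑-cong M λ i →
      PS₁.trans (sumₚ-homo M _) (PS₁.∑-cong M λ j →
      PS₁.trans (*-homo _ _) (PS₁.*-cong (constₚ-homo (F i j))
      (PS₁.trans (*-homo _ _) (PS₁.*-cong (^-homo A i) (^-homo B j))))))

    kron-compose : ∀ F (A B : PS k) → Ord≥ {k} 1 A → Ord≥ {k} 1 B →
      kron {k} (compose {k} F A B) ≈ compose {1} F (kron {k} A) (kron {k} B)
    kron-compose F A B A≥1 B≥1 n = begin
      kron {k} (compose {k} F A B) n
        ≈⟨ kron-agree M _ _ (coeff-compose≈coeff-composeBelow F A B A≥1 B≥1 M) n ℕₚ.≤-refl ⟩
      kron {k} (composeBelow {k} M F A B) n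
        ≈⟨ kron-composeBelow M F A B n ⟩
      composeBelow {1} M F (kron {k} A) (kron {k} B) n
        ≈⟨ coeff-compose≈coeff-composeBelow F _ _ (Ord≥-preserving 1 A A≥1) (Ord≥-preserving 1 B B≥1) M (n ∷ []) n+0<M ⟨
      compose {1} F (kron {k} A) (kron {k} B) n ∎
      where
        open import Relation.Binary.Reasoning.Setoid R.setoid
        M : ℕ
        M = suc n
        n+0<M : n ℕ.+ 0 < M
        n+0<M = ≡.subst (_< M) (≡.sym (ℕₚ.+-identityʳ n)) ℕₚ.≤-refl

module KroneckerInjective {c ℓ} (R : CommutativeRing c ℓ) where
  open PowerSeries R
  open SeriesRing R
  open Evaluation R
  open Kronecker R using (kron; 1≤N^; kron-isKronHom; module IsKronHom)
  private
    module R = CommutativeRing R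
    module PS₀ = Series 0

  digits<next : ∀ W p {s} → s < W → W ℕ.* p ℕ.+ s < W ℕ.* suc p
  digits<next W p s<W = ℕₚ.≤-trans (ℕₚ.+-monoʳ-< (W ℕ.* p) s<W)
    (ℕₚ.≤-reflexive (≡.trans (ℕₚ.+-comm (W ℕ.* p) W) (≡.sym (ℕₚ.*-suc W p))))

  digits<base^suc : ∀ {N W p s} → p < N → s < W → W ℕ.* p ℕ.+ s < N ℕ.* W
  digits<base^suc {N} {W} {p} p<N s<W =
    ℕₚ.<-≤-trans (digits<next W p s<W) (ℕₚ.≤-trans (ℕₚ.*-monoʳ-≤ W p<N) (ℕₚ.≤-reflexive (ℕₚ.*-comm W N)))

  -- The coefficient of τ^(W p + s), s < W, in kron A is made of the digits q ≤ p of A: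
  -- the terms with q < p agree for A and B by hypothesis, so the p-th ones agree too.
  kron-digit : ∀ {k} N (1≤N : 1 ≤ N) (A B : PS (suc k)) {p s} → p < N → s < N ℕ.^ k →
    (∀ q → q < p → _≈ₚ_ {k} (A q) (B q)) →
    kron N 1≤N {suc k} A (N ℕ.^ k ℕ.* p ℕ.+ s) R.≈ kron N 1≤N {suc k} B (N ℕ.^ k ℕ.* p ℕ.+ s) →
    kron N 1≤N {k} (A p) s R.≈ kron N 1≤N {k} (B p) s
  kron-digit {k} N 1≤N A B {p} {s} p<N s<W A<p≈B<p kronA≈kronB =
    ∙-cancelˡ (PS₀.∑ p (digit A)) _ _ (begin
      PS₀.∑ p (digit A) R.+ kron N 1≤N {k} (A p) s ≈⟨ kron≈digits A ⟨
      kron N 1≤N {suc k} A n                       ≈⟨ kronA≈kronB ⟩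
      kron N 1≤N {suc k} B n                       ≈⟨ kron≈digits B ⟩
      PS₀.∑ p (digit B) R.+ kron N 1≤N {k} (B p) s ≈⟨ R.+-congʳ (PS₀.∑-cong< p lowDigits) ⟨
      PS₀.∑ p (digit A) R.+ kron N 1≤N {k} (B p) s ∎)
    where
      open import Algebra.Properties.Group R.+-group using (∙-cancelˡ)
      open import Relation.Binary.Reasoning.Setoid R.setoid
      W n : ℕ
      W = N ℕ.^ k
      n = W ℕ.* p ℕ.+ s
      digit : PS (suc k) → ℕ → R.Carrier
      digit D q = shift (W ℕ.* q) (kron N 1≤N {k} (D q)) n
      p≤n : p ≤ n
      p≤n = ℕₚ.≤-trans (ℕₚ.m≤n*m p W {{ℕ.>-nonZero (1≤N^ N 1≤N k)}}) (ℕₚ.m≤m+n (W ℕ.* p) s)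
      highDigit≈0 : ∀ D i → digit D (suc p ℕ.+ i) R.≈ R.0#
      highDigit≈0 D i = R.reflexive (shift-below (W ℕ.* (suc p ℕ.+ i)) _ n
        (ℕₚ.<-≤-trans (digits<next W p s<W) (ℕₚ.*-monoʳ-≤ W (ℕₚ.m≤m+n (suc p) i))))
      kron≈digits : ∀ D → kron N 1≤N {suc k} D n R.≈ PS₀.∑ p (digit D) R.+ kron N 1≤N {k} (D p) s
      kron≈digits D = begin
        kron N 1≤N {suc k} D n
          ≈⟨ eval-X₁^ W (λ q → kron N 1≤N {k} (D q)) n ⟩
        PS₀.∑ (suc n) (digit D)
          ≈⟨ PS₀.∑-splitAt (suc p) (suc n) (digit D) (s≤s p≤n) ⟩
        PS₀.∑ (suc p) (digit D) R.+ PS₀.∑ (n ∸ p) (λ i → digit D (suc p ℕ.+ i))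
          ≈⟨ R.trans (R.+-congˡ (PS₀.∑-zero (n ∸ p) (λ i _ → highDigit≈0 D i))) (R.+-identityʳ _) ⟩
        PS₀.∑ p (digit D) R.+ digit D p
          ≡⟨ ≡.cong (PS₀.∑ p (digit D) R.+_) (shift-+ (W ℕ.* p) _ s) ⟩
        PS₀.∑ p (digit D) R.+ kron N 1≤N {k} (D p) s ∎
      lowDigits : ∀ q → q < p → digit A q R.≈ digit B q
      lowDigits q q<p = shift-cong (W ℕ.* q) (IsKronHom.cong (kron-isKronHom N 1≤N k) (A<p≈B<p q q<p)) n

  -- The lower bound N₀ lets the induction ask for a base exceeding the current digit.
  kron-injective : ∀ k (A B : PS k) N₀ →
    (∀ N (1≤N : 1 ≤ N) → N₀ ≤ N → ∀ s → s < N ℕ.^ k → kron N 1≤N {k} A s R.≈ kron N 1≤N {k} B s) →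
    _≈ₚ_ {k} A B
  kron-injective zero    A B N₀ agree = agree (N₀ ℕ.⊔ 1) (ℕₚ.m≤n⊔m N₀ 1) (ℕₚ.m≤m⊔n N₀ 1) 0 ℕₚ.≤-refl
  kron-injective (suc k) A B N₀ agree = <-rec (λ p → _≈ₚ_ {k} (A p) (B p)) digitwise
    where
      digitwise : ∀ p → (∀ {q} → q < p → _≈ₚ_ {k} (A q) (B q)) → _≈ₚ_ {k} (A p) (B p)
      digitwise p A<p≈B<p = kron-injective k (A p) (B p) (N₀ ℕ.⊔ suc p) λ N 1≤N N₀⊔p<N s s<W →
        let p<N = ℕₚ.≤-trans (ℕₚ.m≤n⊔m N₀ (suc p)) N₀⊔p<N in
        kron-digit {k} N 1≤N A B p<N s<W (λ q → A<p≈B<p)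
          (agree N 1≤N (ℕₚ.≤-trans (ℕₚ.m≤m⊔n N₀ (suc p)) N₀⊔p<N) _ (digits<base^suc p<N s<W))

module LiftToSeveralVariables {c ℓ} (R : CommutativeRing c ℓ) (F : PowerSeries.PS R 2) where
  open PowerSeries R
  open SeriesRing R
  open Order R
  open Composition R
  open Kronecker R using (kron; module IsKronHom; kron-isKronHom; kron-compose)
  open KroneckerInjective R
  private
    module R = CommutativeRing R
    module PS₁ = Series 1

  compose-comm : (∀ (g h : PS 1) → Ord≥ {1} 1 g → Ord≥ {1} 1 h → _≈ₚ_ {1} (compose {1} F g h) (compose {1} F h g)) →
    ∀ {k} (A B : PS k) → Ord≥ {k} 1 A → Ord≥ {k} 1 B → _≈ₚ_ {k} (compose {k} F A B) (compose {k} F B A)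
  compose-comm comm₁ {k} A B A≥1 B≥1 = kron-injective k _ _ 1 λ N 1≤N _ s _ → kron-equal N 1≤N s
    where
      kron-equal : ∀ N (1≤N : 1 ≤ N) → kron N 1≤N {k} (compose {k} F A B) PS₁.≈ kron N 1≤N {k} (compose {k} F B A)
      kron-equal N 1≤N = begin
        kron N 1≤N {k} (compose {k} F A B)
          ≈⟨ kron-compose N 1≤N F A B A≥1 B≥1 ⟩
        compose {1} F (kron N 1≤N {k} A) (kron N 1≤N {k} B)
          ≈⟨ comm₁ _ _ (Ord≥-preserving 1 A A≥1) (Ord≥-preserving 1 B B≥1) ⟩
        compose {1} F (kron N 1≤N {k} B) (kron N 1≤N {k} A)
          ≈⟨ kron-compose N 1≤N F B A B≥1 A≥1 ⟨
        kron N 1≤N {k} (compose {k} F B A) ∎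
        where
          open IsKronHom N 1≤N (kron-isKronHom N 1≤N k) using (Ord≥-preserving)
          open import Relation.Binary.Reasoning.Setoid PS₁.setoid

  compose-assoc : constTerm {2} F R.≈ R.0# →
    (∀ (g h e : PS 1) → Ord≥ {1} 1 g → Ord≥ {1} 1 h → Ord≥ {1} 1 e →
      _≈ₚ_ {1} (compose {1} F (compose {1} F g h) e) (compose {1} F g (compose {1} F h e))) →
    ∀ {k} (A B C : PS k) → Ord≥ {k} 1 A → Ord≥ {k} 1 B → Ord≥ {k} 1 C →
    _≈ₚ_ {k} (compose {k} F (compose {k} F A B) C) (compose {k} F A (compose {k} F B C))
  compose-assoc F₀₀≈0 assoc₁ {k} A B C A≥1 B≥1 C≥1 = kron-injective k _ _ 1 λ N 1≤N _ s _ → kron-equal N 1≤N s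
    where
      kron-equal : ∀ N (1≤N : 1 ≤ N) →
        kron N 1≤N {k} (compose {k} F (compose {k} F A B) C) PS₁.≈ kron N 1≤N {k} (compose {k} F A (compose {k} F B C))
      kron-equal N 1≤N = begin
        κ (compose {k} F (compose {k} F A B) C)
          ≈⟨ κ-compose _ C (Ord≥1-compose F F₀₀≈0 A≥1 B≥1) C≥1 ⟩
        compose {1} F (κ (compose {k} F A B)) (κ C)
          ≈⟨ compose-cong {1} F (κ-compose A B A≥1 B≥1) PS₁.refl ⟩
        compose {1} F (compose {1} F (κ A) (κ B)) (κ C)
          ≈⟨ assoc₁ _ _ _ (Ord≥-preserving 1 A A≥1) (Ord≥-preserving 1 B B≥1) (Ord≥-preserving 1 C C≥1) ⟩
        compose {1} F (κ A) (compose {1} F (κ B) (κ C))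
          ≈⟨ compose-cong {1} F PS₁.refl (κ-compose B C B≥1 C≥1) ⟨
        compose {1} F (κ A) (κ (compose {k} F B C))
          ≈⟨ κ-compose A _ A≥1 (Ord≥1-compose F F₀₀≈0 B≥1 C≥1) ⟨
        κ (compose {k} F A (compose {k} F B C))
          ∎
        where
          open IsKronHom N 1≤N (kron-isKronHom N 1≤N k) using (Ord≥-preserving)
          open import Relation.Binary.Reasoning.Setoid PS₁.setoid
          κ : PS k → PS 1
          κ = kron N 1≤N {k}
          κ-compose : ∀ (A B : PS k) → Ord≥ {k} 1 A → Ord≥ {k} 1 B → κ (compose {k} F A B) PS₁.≈ compose {1} F (κ A) (κ B)
          κ-compose = kron-compose N 1≤N F

module InjectiveHomomorphism {c ℓ c′ ℓ′} (R : CommutativeRing c ℓ) (G : AbelianGroup c′ ℓ′) where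
  open PowerSeries R
  open Order R
  open Composition R
  private
    module R = CommutativeRing R
    module G = AbelianGroup G
    module PS₁ = SeriesRing.Series R 1

  module OneVariableLaws
    (T : τPS → G.Carrier)
    (T-injective : ∀ (g h : τPS) → T g G.≈ T h → _≈ₚ_ {1} (proj₁ g) (proj₁ h))
    (F : PS 2) (F₀₀≈0 : constTerm {2} F R.≈ R.0#)
    (T-homo : ∀ (g h : PS 1) (pg : g 0 R.≈ R.0#) (ph : h 0 R.≈ R.0#) (pF : compose {1} F g h 0 R.≈ R.0#) →
      (T (g , pg) G.∙ T (h , ph)) G.≈ T (compose {1} F g h , pF))
    where
    open import Relation.Binary.Reasoning.Setoid G.setoid

    F⟨_,_⟩ : PS 1 → PS 1 → PS 1
    F⟨ g , h ⟩ = compose {1} F g h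

    F⟨⟩≥1 : ∀ {g h} → Ord≥ {1} 1 g → Ord≥ {1} 1 h → Ord≥ {1} 1 F⟨ g , h ⟩
    F⟨⟩≥1 = Ord≥1-compose {1} F F₀₀≈0

    T⟨_⟩ : ∀ {g} → Ord≥ {1} 1 g → G.Carrier
    T⟨_⟩ {g} g≥1 = T (g , Ord≥1⇒const≈0 g≥1)

    T-F : ∀ {g h} (g≥1 : Ord≥ {1} 1 g) (h≥1 : Ord≥ {1} 1 h) →
      T⟨ g≥1 ⟩ G.∙ T⟨ h≥1 ⟩ G.≈ T⟨ F⟨⟩≥1 g≥1 h≥1 ⟩
    T-F {g} {h} _ _ = T-homo g h _ _ _

    compose₁-comm : ∀ (g h : PS 1) → Ord≥ {1} 1 g → Ord≥ {1} 1 h → _≈ₚ_ {1} F⟨ g , h ⟩ F⟨ h , g ⟩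
    compose₁-comm g h g≥1 h≥1 = T-injective _ _ (begin
      T⟨ F⟨⟩≥1 g≥1 h≥1 ⟩    ≈⟨ T-F g≥1 h≥1 ⟨
      T⟨ g≥1 ⟩ G.∙ T⟨ h≥1 ⟩ ≈⟨ G.comm _ _ ⟩
      T⟨ h≥1 ⟩ G.∙ T⟨ g≥1 ⟩ ≈⟨ T-F h≥1 g≥1 ⟩
      T⟨ F⟨⟩≥1 h≥1 g≥1 ⟩    ∎)

    compose₁-assoc : ∀ (g h e : PS 1) → Ord≥ {1} 1 g → Ord≥ {1} 1 h → Ord≥ {1} 1 e →
      _≈ₚ_ {1} F⟨ F⟨ g , h ⟩ , e ⟩ F⟨ g , F⟨ h , e ⟩ ⟩
    compose₁-assoc g h e g≥1 h≥1 e≥1 = T-injective _ _ (begin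
      T⟨ F⟨⟩≥1 gh≥1 e≥1 ⟩                   ≈⟨ T-F gh≥1 e≥1 ⟨
      T⟨ gh≥1 ⟩ G.∙ T⟨ e≥1 ⟩                ≈⟨ G.∙-congʳ (T-F g≥1 h≥1) ⟨
      (T⟨ g≥1 ⟩ G.∙ T⟨ h≥1 ⟩) G.∙ T⟨ e≥1 ⟩  ≈⟨ G.assoc _ _ _ ⟩
      T⟨ g≥1 ⟩ G.∙ (T⟨ h≥1 ⟩ G.∙ T⟨ e≥1 ⟩)  ≈⟨ G.∙-congˡ (T-F h≥1 e≥1) ⟩
      T⟨ g≥1 ⟩ G.∙ T⟨ he≥1 ⟩                ≈⟨ T-F g≥1 he≥1 ⟩
      T⟨ F⟨⟩≥1 g≥1 he≥1 ⟩                   ∎)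
      where
        gh≥1 : Ord≥ {1} 1 F⟨ g , h ⟩
        gh≥1 = F⟨⟩≥1 g≥1 h≥1
        he≥1 : Ord≥ {1} 1 F⟨ h , e ⟩
        he≥1 = F⟨⟩≥1 h≥1 e≥1

    compose-X₁-0ₚ : T (0ₚ {1} , R.refl) G.≈ G.ε → _≈ₚ_ {1} F⟨ X₁ , 0ₚ {1} ⟩ X₁
    compose-X₁-0ₚ T0≈ε = PS₁.sym (T-injective _ _ (begin
      T (X₁ , R.refl)                          ≈⟨ G.identityʳ _ ⟨
      T (X₁ , R.refl) G.∙ G.ε                  ≈⟨ G.∙-congˡ T0≈ε ⟨
      T (X₁ , R.refl) G.∙ T (0ₚ {1} , R.refl)  ≈⟨ T-homo X₁ (0ₚ {1}) R.refl R.refl _ ⟩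
      T⟨ F⟨⟩≥1 (Ord≥1-var {1} Fin.zero) (Ord≥-0ₚ {1} 1) ⟩ ∎))

proposition1p2 : ∀ {c ℓ c′ ℓ′} (R : CommutativeRing c ℓ) (G : AbelianGroup c′ ℓ′) →
    let open PowerSeries R
        module R = CommutativeRing R
        module G = AbelianGroup G
    in (T : τPS → G.Carrier) →
       -- T is a well-defined map on τR[[τ]] (respects coefficientwise equality)
       (∀ (g h : τPS) → _≈ₚ_ {1} (proj₁ g) (proj₁ h) → T g G.≈ T h) →
       -- T injective
       (∀ (g h : τPS) → T g G.≈ T h → _≈ₚ_ {1} (proj₁ g) (proj₁ h)) →
       -- T(0) = 0_G
       T (0ₚ {1} , R.refl) G.≈ G.ε →
       (F : PS 2) → constTerm {2} F R.≈ R.0# →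
       (∀ (g h : PS 1) (pg : g 0 R.≈ R.0#) (ph : h 0 R.≈ R.0#)
          (pF : compose {1} F g h 0 R.≈ R.0#) →
          (T (g , pg) G.∙ T (h , ph)) G.≈ T (compose {1} F g h , pF)) →
       IsFormalGroupLaw F
proposition1p2 R G T _ T-injective T0≈ε F F₀₀≈0 T-homo = record
  { identity    = compose-X₁-0ₚ T0≈ε
  ; commutative = compose-comm compose₁-comm {2} X₂ Y₂ (Ord≥1-var {2} x) (Ord≥1-var {2} y)
  ; associative = compose-assoc F₀₀≈0 compose₁-assoc {3} X₃ Y₃ Z₃
                    (Ord≥1-var {3} x) (Ord≥1-var {3} y) (Ord≥1-var {3} z)
  }
  where
    open PowerSeries R
    open Order R
    open InjectiveHomomorphism.OneVariableLaws R G T T-injective F F₀₀≈0 T-homo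
    open LiftToSeveralVariables R F
    x : ∀ {k} → Fin (suc k)
    x = Fin.zero
    y : ∀ {k} → Fin (suc (suc k))
    y = Fin.suc x
    z : Fin 3
    z = Fin.suc y
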